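{- For every integer $\ell$, both $\mathfrak{B}_\ell$ and $\mathfrak{B}_\ell^{\mathrm{rev}}$ are monotonic subset selectors.
   Context: Consider undirected bipartite graphs with fixed bipartition, written $G=(X,Y,E)$ (left side $X$, right side $Y$). A subset selector $f$ assigns to each such $G$ a set $f(G)\subseteq V(G)$; its reverse is $f^{\mathrm{rev}}((X,Y,E))=f((Y,X,E))$. $f$ is monotonic if for every $G=(X,Y,E)$ and $w\in Y$, with $G'=G\setminus w$ (bipartition $(X,Y\setminus\{w\})$), we have $f(G)\cap X\supseteq f(G')\cap X$ and $f(G)\cap(Y\setminus\{w\})\subseteq f(G')\cap Y$. A vertex $v$ with degree $d(v)>\ell$ is $\ell$-important, otherwise $\ell$-unimportant. The Buss selector $\mathfrak{B}_\ell(G)$ is the set of all vertices of $X$ that are $\ell$-important or have at least one $\ell$-unimportant neighbour. -}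

module Defs where

open import Data.Nat using (ℕ; suc)
open import Data.Integer using (ℤ; +_; _<_)
open import Data.Fin using (Fin; punchIn)
open import Data.List using (length; filterᵇ; allFin)
open import Data.Bool using (Bool; true)
open import Data.Sum using (_⊎_; inj₁; inj₂)
open import Data.Product using (_×_; ∃)
open import Data.Empty using (⊥)
open import Relation.Nullary using (¬_)
open import Relation.Binary.PropositionalEquality using (_≡_)

-- A finite bipartite graph with fixed bipartition G = (X, Y, E):
-- left side X = Fin m, right side Y = Fin n, E x y = true iff {x,y} is an edge.
BGraph : ℕ → ℕ → Set
BGraph m n = Fin m → Fin n → Bool

Vertex : ℕ → ℕ → Set
Vertex m n = Fin m ⊎ Fin n

swapG : ∀ {m n} → BGraph m n → BGraph n m
swapG E y x = E x y

swapV : ∀ {m n} → Vertex m n → Vertex n m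
swapV (inj₁ x) = inj₂ x
swapV (inj₂ y) = inj₁ y

degree : ∀ {m n} → BGraph m n → Vertex m n → ℕ
degree {m} {n} E (inj₁ x) = length (filterᵇ (λ y → E x y) (allFin n))
degree {m} {n} E (inj₂ y) = length (filterᵇ (λ x → E x y) (allFin m))

Important : ℤ → ∀ {m n} → BGraph m n → Vertex m n → Set
Important ℓ E v = ℓ < + degree E v

Unimportant : ℤ → ∀ {m n} → BGraph m n → Vertex m n → Set
Unimportant ℓ E v = ¬ Important ℓ E v

Selector : Set₁
Selector = ∀ {m n} → BGraph m n → Vertex m n → Set

-- f^rev((X,Y,E)) = f((Y,X,E))  (as a subset of the same vertex set)
rev : Selector → Selector
rev f E v = f (swapG E) (swapV v)

-- G ∖ w for w ∈ Y : right side Y ∖ {w} ≅ Fin n via punchIn w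
deleteY : ∀ {m n} → BGraph m (suc n) → Fin (suc n) → BGraph m n
deleteY E w x y = E x (punchIn w y)

Monotonic : Selector → Set
Monotonic f = ∀ {m n} (G : BGraph m (suc n)) (w : Fin (suc n)) →
  (∀ x → f (deleteY G w) (inj₁ x) → f G (inj₁ x)) ×
  (∀ y → f G (inj₂ (punchIn w y)) → f (deleteY G w) (inj₂ y))

Buss : ℤ → Selector
Buss ℓ E (inj₁ x) = Important ℓ E (inj₁ x) ⊎ ∃ (λ y → (E x y ≡ true) × Unimportant ℓ E (inj₂ y))
Buss ℓ E (inj₂ y) = ⊥

module Submission where

-- Deleting a right vertex w from G = (X, Y, E) removes at most one edge at
-- each left vertex and changes nothing at the remaining right vertices.
-- Hence left degrees can only drop, while right degrees (and the
-- adjacencies among surviving vertices) stay the same.  Both Buss ℓ and its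
-- reverse only ever select vertices of one side, and the selection rule is
-- "important, or adjacent to an unimportant vertex of the other side":
--   * for Buss ℓ (selecting in X), a left vertex important in G ∖ w is
--     important in G, and an unimportant neighbour y in G ∖ w is the same
--     unimportant neighbour in G;
--   * for the reverse (selecting in Y), an important right vertex stays
--     important, and an unimportant left neighbour in G stays unimportant
--     in G ∖ w because its degree has not grown.
-- The only counting fact needed is thus `degree-deleteY-≤`, which follows
-- from the list embedding of the indices Fin n into Fin (suc n) via
-- punchIn w, pushed through filtering and length.

open import Defs
open import Data.Integer using (ℤ; +≤+)
open import Data.Integer.Properties using (<-≤-trans)
open import Data.Nat using (suc; _≤_)
open import Data.Fin using (Fin; zero; suc; punchIn)
open import Data.List using (tabulate; allFin)
open import Data.List.Relation.Binary.Sublist.Heterogeneous using (Sublist; _∷_; _∷ʳ_)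
open import Data.List.Relation.Binary.Sublist.Heterogeneous.Properties
  using (length-mono-≤; ⊆-filter-Sublist; fromPointwise)
open import Data.List.Relation.Binary.Pointwise using (tabulate⁺)
open import Data.Bool.Properties using (T?)
open import Data.Product using (_×_; _,_)
open import Data.Sum using (inj₁; inj₂)
open import Relation.Binary.PropositionalEquality using (_≡_; refl)

tabulate-punchIn : ∀ {a b r} {A : Set a} {B : Set b} {R : A → B → Set r} {n}
  (w : Fin (suc n)) (h : Fin n → A) (f : Fin (suc n) → B) →
  (∀ i → R (h i) (f (punchIn w i))) →
  Sublist R (tabulate h) (tabulate f)
tabulate-punchIn zero h f rel = f zero ∷ʳ fromPointwise (tabulate⁺ rel)
tabulate-punchIn {n = suc n} (suc w) h f rel =
  rel zero ∷ tabulate-punchIn w (λ i → h (suc i)) (λ i → f (suc i)) (λ i → rel (suc i))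

degree-deleteY-≤ : ∀ {m n} (G : BGraph m (suc n)) (w : Fin (suc n)) (x : Fin m) →
  degree (deleteY G w) (inj₁ x) ≤ degree G (inj₁ x)
degree-deleteY-≤ G w x =
  length-mono-≤ (⊆-filter-Sublist (λ y → T? (G x (punchIn w y))) (λ y → T? (G x y))
                                  (λ { refl edge → edge }) punchIn-embedding)
  where
  punchIn-embedding : Sublist (λ y y′ → punchIn w y ≡ y′) (allFin _) (allFin _)
  punchIn-embedding = tabulate-punchIn w (λ y → y) (λ y → y) (λ y → refl)

important-deleteY : ∀ ℓ {m n} (G : BGraph m (suc n)) (w : Fin (suc n)) (x : Fin m) →
  Important ℓ (deleteY G w) (inj₁ x) → Important ℓ G (inj₁ x)
important-deleteY ℓ G w x imp = <-≤-trans imp (+≤+ (degree-deleteY-≤ G w x))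

lemma29 : (ℓ : ℤ) → Monotonic (Buss ℓ) × Monotonic (rev (Buss ℓ))
lemma29 ℓ = (λ G w → buss-left G w , λ y ()) , (λ G w → (λ x ()) , rev-right G w)
  where
  buss-left : ∀ {m n} (G : BGraph m (suc n)) (w : Fin (suc n)) (x : Fin m) →
    Buss ℓ (deleteY G w) (inj₁ x) → Buss ℓ G (inj₁ x)
  buss-left G w x (inj₁ imp)         = inj₁ (important-deleteY ℓ G w x imp)
  buss-left G w x (inj₂ (y , e , u)) = inj₂ (punchIn w y , e , u)

  rev-right : ∀ {m n} (G : BGraph m (suc n)) (w : Fin (suc n)) (y : Fin n) →
    rev (Buss ℓ) G (inj₂ (punchIn w y)) → rev (Buss ℓ) (deleteY G w) (inj₂ y)
  rev-right G w y (inj₁ imp)         = inj₁ imp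
  rev-right G w y (inj₂ (x , e , u)) = inj₂ (x , e , λ imp → u (important-deleteY ℓ G w x imp))
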